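{- Let $S,T_1,T_2$ be term graphs and $u,v$ nodes such that $S\unrhd_{u'\mapsto u}T_1$ and $S\unrhd_{v'\mapsto v}T_2$ for some nodes $u',v'$. Then there exist nodes $w_1,w_2\in\{u,v\}$, nodes $x_1,x_2$ and a term graph $U$ such that $T_1\unrhd_{x_1\mapsto w_1}U$ and $T_2\unrhd_{x_2\mapsto w_2}U$. (That is, ${\unlhd_{\cdot\mapsto u}}\cdot{\unrhd_{\cdot\mapsto v}}\subseteq{\unrhd_{\cdot\mapsto w_1}}\cdot{\unlhd_{\cdot\mapsto w_2}}$ with $w_1,w_2\in\{u,v\}$.)
   Context: A term graph $S$ over signature $\mathcal F$ and variables $\mathcal V$ is a finite acyclic rooted graph (root $\mathrm{rt}(S)$ from which all nodes are reachable) with labels $\mathrm{lab}_S$ in $\mathcal F\cup\mathcal V$ and ordered successor lists $\mathrm{succ}_S(u)$, where a node labelled with a $k$-ary $f$ has $k$ successors, variable nodes have none, and equal variable labels imply equal nodes. $S\geq_m T$ means $m$ maps nodes of $S$ to nodes of $T$, $m(\mathrm{rt}(S))=\mathrm{rt}(T)$, and for all nodes $w$ of $S$: $\mathrm{lab}_T(m(w))=\mathrm{lab}_S(w)$ and $\mathrm{succ}_T(m(w))=m^*(\mathrm{succ}_S(w))$. Fix a strict total order $\succ$ on nodes, with reflexive closure $\succeq$. For nodes $u\succeq v$ of $S$, $S\unrhd_{u\mapsto v}T$ means $T$ is a term graph and $S\geq_m T$ for the map $m(u)=v$, $m(w)=w$ for $w\neq u$ (in particular $S\unrhd_{v\mapsto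 v}S$). $T\unlhd_{\cdot\mapsto u}S$ denotes $S\unrhd_{u'\mapsto u}T$ for some $u'$. -}

module Defs where

open import Data.Nat using (ℕ)
open import Data.Sum using (_⊎_; inj₁; inj₂)
open import Data.Product using (_×_; Σ)
open import Data.Empty using (⊥)
open import Data.List using (List; []; length; map)
open import Data.List.Membership.Propositional using (_∈_)
open import Data.List.Relation.Unary.All using (All)
open import Relation.Nullary using (¬_; yes; no)
open import Relation.Binary using (IsStrictTotalOrder; DecidableEquality)
open import Relation.Binary.PropositionalEquality using (_≡_)
open import Relation.Binary.Construct.Closure.ReflexiveTransitive using (Star)
open import Relation.Binary.Construct.Closure.Transitive using (TransClosure)

-- The node set is finite (given by a list); lab and succ are total functions
-- on N but only their values on the nodes of the graph matter.
record TermGraph {F : Set} (arity : F → ℕ) (V N : Set) : Set where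
  field
    nodes : List N
    root  : N
    lab   : N → F ⊎ V
    succ  : N → List N
    root∈ : root ∈ nodes
    succ∈ : ∀ {a} → a ∈ nodes → All (_∈ nodes) (succ a)
    arityOK : ∀ {a f} → a ∈ nodes → lab a ≡ inj₁ f → length (succ a) ≡ arity f
    varLeaf : ∀ {a x} → a ∈ nodes → lab a ≡ inj₂ x → succ a ≡ []
    varUnique : ∀ {a b x} → a ∈ nodes → b ∈ nodes →
                lab a ≡ inj₂ x → lab b ≡ inj₂ x → a ≡ b

  Edge : N → N → Set
  Edge a b = (a ∈ nodes) × (b ∈ succ a)

  field
    acyclic : ∀ {a} → ¬ TransClosure Edge a a
    rooted  : ∀ {a} → a ∈ nodes → Star Edge root a

open TermGraph public

Hom : {F : Set} {arity : F → ℕ} {V N : Set} →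
      TermGraph arity V N → TermGraph arity V N → (N → N) → Set
Hom S T m =
  (m (root S) ≡ root T) ×
  (∀ {w} → w ∈ nodes S →
     (m w ∈ nodes T) ×
     (lab T (m w) ≡ lab S w) ×
     (succ T (m w) ≡ map m (succ S w)))

redirect : {N : Set} → DecidableEquality N → N → N → N → N
redirect _≟_ u v w with w ≟ u
... | yes _ = v
... | no _  = w

Redirect : {F : Set} {arity : F → ℕ} {V N : Set} →
           (_≻_ : N → N → Set) → IsStrictTotalOrder _≡_ _≻_ →
           TermGraph arity V N → N → N → TermGraph arity V N → Set
Redirect _≻_ sto S u v T =
  (u ∈ nodes S) × (v ∈ nodes S) × ((u ≡ v) ⊎ (u ≻ v)) ×
  Hom S T (redirect (IsStrictTotalOrder._≟_ sto) u v)

-- Redirecting u′ to u ≠ u′ only yields a term graph when u′ and u are twins in S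
-- (same label, same successor list): otherwise acyclicity of S or of the result breaks.
-- So every redirection, and every composite of redirections, is a collapse of S, an
-- endomap sending each node to a twin, and the image of S under a collapse m is again a
-- term graph. If m = m′ ∘ [u′ ↦ u], then [u′ ↦ u](S) ≥_{m′} m(S). Hence it suffices to
-- find redirections r₁, r₂ with r₁ ∘ [u′ ↦ u] = r₂ ∘ [v′ ↦ v] and to take U to be the
-- image of S under this map. By cases: one redirection is the identity; equal sources,
-- where the larger target is redirected to the smaller; a chain v′ ↦ u′ ↦ u; and
-- disjoint redirections, which commute.

module Submission where

open import Defs
open import Data.Nat using (ℕ)
open import Data.Sum using (_⊎_; inj₁; inj₂)
import Data.Sum as Sum
open import Data.Product using (Σ; _×_; _,_; proj₁; proj₂)
open import Data.Empty using (⊥-elim)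
open import Function using (id; _∘_)
open import Data.List using (map)
open import Data.List.Properties using (length-map; map-∘; map-cong; map-id-local)
open import Data.List.Membership.Propositional using (_∈_)
open import Data.List.Membership.Propositional.Properties using (∈-map⁺; ∈-map⁻)
import Data.List.Relation.Unary.All as All
open import Relation.Nullary using (¬_; Dec; yes; no)
open import Relation.Binary using (IsStrictTotalOrder; DecidableEquality; tri<; tri≈; tri>)
open import Relation.Binary.PropositionalEquality
  using (_≡_; _≢_; _≗_; refl; sym; trans; cong; subst; module ≡-Reasoning)
open import Relation.Binary.Construct.Closure.ReflexiveTransitive using (Star; ε; _◅_; gmap)
open import Relation.Binary.Construct.Closure.Transitive using (TransClosure; [_]; _∷_)

module Redirection {N : Set} (_≟_ : DecidableEquality N) where

  open ≡-Reasoning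

  [_↦_] : N → N → N → N
  [ a ↦ b ] = redirect _≟_ a b

  ↦-source : ∀ a b → [ a ↦ b ] a ≡ b
  ↦-source a b with a ≟ a
  ... | yes _ = refl
  ... | no a≢a = ⊥-elim (a≢a refl)

  ↦-other : ∀ {a b w} → w ≢ a → [ a ↦ b ] w ≡ w
  ↦-other {a} {w = w} w≢a with w ≟ a
  ... | yes w≡a = ⊥-elim (w≢a w≡a)
  ... | no _ = refl

  ↦-target : ∀ a b → [ a ↦ b ] b ≡ b
  ↦-target a b with b ≟ a
  ... | yes _ = refl
  ... | no _ = refl

  ↦-refl : ∀ a → [ a ↦ a ] ≗ id
  ↦-refl a w with w ≟ a
  ... | yes w≡a = sym w≡a
  ... | no _ = refl

  map-↦-fresh : ∀ {a b xs} → (∀ {c} → c ∈ xs → c ≢ a) → map [ a ↦ b ] xs ≡ xs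
  map-↦-fresh fresh = map-id-local (All.tabulate (↦-other ∘ fresh))

  ↦-absorb : ∀ a b c → [ b ↦ c ] ∘ [ a ↦ b ] ≗ [ b ↦ c ] ∘ [ a ↦ c ]
  ↦-absorb a b c w with w ≟ a
  ... | yes _ = trans (↦-source b c) (sym (↦-target b c))
  ... | no _ = refl

  ↦-chain : ∀ {a b c} → b ≢ c → a ≢ c → [ c ↦ b ] ∘ [ a ↦ b ] ≗ [ a ↦ b ] ∘ [ c ↦ a ]
  ↦-chain {a} {b} {c} b≢c a≢c w = cases w (w ≟ a) (w ≟ c)
    where
    cases : ∀ w → Dec (w ≡ a) → Dec (w ≡ c) → [ c ↦ b ] ([ a ↦ b ] w) ≡ [ a ↦ b ] ([ c ↦ a ] w)
    cases w (yes refl) _ = begin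
      [ c ↦ b ] ([ w ↦ b ] w) ≡⟨ cong [ c ↦ b ] (↦-source w b) ⟩
      [ c ↦ b ] b             ≡⟨ ↦-other b≢c ⟩
      b                       ≡⟨ ↦-source w b ⟨
      [ w ↦ b ] w             ≡⟨ cong [ w ↦ b ] (↦-other a≢c) ⟨
      [ w ↦ b ] ([ c ↦ w ] w) ∎
    cases w (no w≢a) (yes refl) = begin
      [ w ↦ b ] ([ a ↦ b ] w) ≡⟨ cong [ w ↦ b ] (↦-other w≢a) ⟩
      [ w ↦ b ] w             ≡⟨ ↦-source w b ⟩
      b                       ≡⟨ ↦-source a b ⟨
      [ a ↦ b ] a             ≡⟨ cong [ a ↦ b ] (↦-source w a) ⟨
      [ a ↦ b ] ([ w ↦ a ] w) ∎
    cases w (no w≢a) (no w≢c) = begin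
      [ c ↦ b ] ([ a ↦ b ] w) ≡⟨ cong [ c ↦ b ] (↦-other w≢a) ⟩
      [ c ↦ b ] w             ≡⟨ ↦-other w≢c ⟩
      w                       ≡⟨ ↦-other w≢a ⟨
      [ a ↦ b ] w             ≡⟨ cong [ a ↦ b ] (↦-other w≢c) ⟨
      [ a ↦ b ] ([ c ↦ a ] w) ∎

  ↦-comm : ∀ {a b c d} → a ≢ c → a ≢ d → b ≢ c → [ c ↦ d ] ∘ [ a ↦ b ] ≗ [ a ↦ b ] ∘ [ c ↦ d ]
  ↦-comm {a} {b} {c} {d} a≢c a≢d b≢c w = cases w (w ≟ a) (w ≟ c)
    where
    cases : ∀ w → Dec (w ≡ a) → Dec (w ≡ c) → [ c ↦ d ] ([ a ↦ b ] w) ≡ [ a ↦ b ] ([ c ↦ d ] w)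
    cases w (yes refl) _ = begin
      [ c ↦ d ] ([ w ↦ b ] w) ≡⟨ cong [ c ↦ d ] (↦-source w b) ⟩
      [ c ↦ d ] b             ≡⟨ ↦-other b≢c ⟩
      b                       ≡⟨ ↦-source w b ⟨
      [ w ↦ b ] w             ≡⟨ cong [ w ↦ b ] (↦-other a≢c) ⟨
      [ w ↦ b ] ([ c ↦ d ] w) ∎
    cases w (no w≢a) (yes refl) = begin
      [ w ↦ d ] ([ a ↦ b ] w) ≡⟨ cong [ w ↦ d ] (↦-other w≢a) ⟩
      [ w ↦ d ] w             ≡⟨ ↦-source w d ⟩
      d                       ≡⟨ ↦-other (a≢d ∘ sym) ⟨
      [ a ↦ b ] d             ≡⟨ cong [ a ↦ b ] (↦-source w d) ⟨
      [ a ↦ b ] ([ w ↦ d ] w) ∎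
    cases w (no w≢a) (no w≢c) = begin
      [ c ↦ d ] ([ a ↦ b ] w) ≡⟨ cong [ c ↦ d ] (↦-other w≢a) ⟩
      [ c ↦ d ] w             ≡⟨ ↦-other w≢c ⟩
      w                       ≡⟨ ↦-other w≢a ⟨
      [ a ↦ b ] w             ≡⟨ cong [ a ↦ b ] (↦-other w≢c) ⟨
      [ a ↦ b ] ([ c ↦ d ] w) ∎

module TermGraphs {F : Set} (arity : F → ℕ) (V N : Set) where

  TG : Set
  TG = TermGraph arity V N

  record Twins (S : TG) (a b : N) : Set where
    constructor twins
    field
      lab≡  : lab S a ≡ lab S b
      succ≡ : succ S a ≡ succ S b

  twins-refl : ∀ {S a} → Twins S a a
  twins-refl = twins refl refl

  twins-sym : ∀ {S a b} → Twins S a b → Twins S b a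
  twins-sym (twins l s) = twins (sym l) (sym s)

  twins-trans : ∀ {S a b c} → Twins S a b → Twins S b c → Twins S a c
  twins-trans (twins l s) (twins l′ s′) = twins (trans l l′) (trans s s′)

  IsCollapse : TG → (N → N) → Set
  IsCollapse S m = ∀ {x} → x ∈ nodes S → (m x ∈ nodes S) × Twins S x (m x)

  collapse-∘ : ∀ {S f g} → IsCollapse S f → IsCollapse S g → IsCollapse S (g ∘ f)
  collapse-∘ cf cg x∈ =
    let fx∈ , tf = cf x∈ ; gfx∈ , tg = cg fx∈ in gfx∈ , twins-trans tf tg

  hom-onto : ∀ {S T : TG} {m} → Hom S T m →
             ∀ {t} → t ∈ nodes T → Σ N λ s → (s ∈ nodes S) × (m s ≡ t)
  hom-onto {S} {T} {m} (rt , h) t∈ =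
    go (root∈ S) (subst (λ r → Star (Edge T) r _) (sym rt) (rooted T t∈))
    where
    go : ∀ {s t} → s ∈ nodes S → Star (Edge T) (m s) t → Σ N λ s → (s ∈ nodes S) × (m s ≡ t)
    go s∈ ε = _ , s∈ , refl
    go s∈ ((_ , b∈) ◅ path) with ∈-map⁻ m (subst (_ ∈_) (proj₂ (proj₂ (h s∈))) b∈)
    ... | c , c∈ , refl = go (All.lookup (succ∈ S s∈) c∈) path

  hom-node : ∀ {S T : TG} {m w w′} → Hom S T m → w ∈ nodes S → m w ≡ w′ →
             (w′ ∈ nodes T) × (lab T w′ ≡ lab S w) × (succ T w′ ≡ map m (succ S w))
  hom-node (_ , h) w∈ refl = h w∈

  module Collapse (S : TG) {m : N → N} (c : IsCollapse S m) where

    lab-preserved : ∀ {x} → x ∈ nodes S → lab S x ≡ lab S (m x)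
    lab-preserved x∈ = Twins.lab≡ (proj₂ (c x∈))

    succ-preserved : ∀ {x} → x ∈ nodes S → succ S x ≡ succ S (m x)
    succ-preserved x∈ = Twins.succ≡ (proj₂ (c x∈))

    image⊆ : ∀ {a} → a ∈ map m (nodes S) → a ∈ nodes S
    image⊆ a∈ with ∈-map⁻ m a∈
    ... | _ , a₀∈ , refl = proj₁ (c a₀∈)

    Edge/ : N → N → Set
    Edge/ a b = (a ∈ map m (nodes S)) × (b ∈ map m (succ S a))

    push-edge : ∀ {x y} → Edge S x y → Edge/ (m x) (m y)
    push-edge (x∈ , y∈) = ∈-map⁺ m x∈ , ∈-map⁺ m (subst (_ ∈_) (succ-preserved x∈) y∈)

    lift-edge : ∀ {x b} → x ∈ nodes S → b ∈ map m (succ S (m x)) →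
                Σ N λ y → Edge S x y × (m y ≡ b)
    lift-edge x∈ b∈ with ∈-map⁻ m (subst (λ l → _ ∈ map m l) (sym (succ-preserved x∈)) b∈)
    ... | y , y∈ , refl = y , (x∈ , y∈) , refl

    lift-path : ∀ {x b} → x ∈ nodes S → TransClosure Edge/ (m x) b →
                Σ N λ y → (y ∈ nodes S) × TransClosure (Edge S) x y × (m y ≡ b)
    lift-path x∈ [ _ , b∈ ] =
      let y , e , my≡b = lift-edge x∈ b∈ in
      y , All.lookup (succ∈ S x∈) (proj₂ e) , [ e ] , my≡b
    lift-path x∈ ((_ , b∈) ∷ path) with lift-edge x∈ b∈
    ... | y , e , refl =
      let z , z∈ , path′ , mz≡b = lift-path (All.lookup (succ∈ S x∈) (proj₂ e)) path in
      z , z∈ , e ∷ path′ , mz≡b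

    restart : ∀ {a a′ b} → a′ ∈ nodes S → succ S a ≡ succ S a′ →
              TransClosure (Edge S) a b → TransClosure (Edge S) a′ b
    restart a′∈ same [ _ , y∈ ] = [ a′∈ , subst (_ ∈_) same y∈ ]
    restart a′∈ same ((_ , y∈) ∷ path) = (a′∈ , subst (_ ∈_) same y∈) ∷ path

    source∈ : ∀ {a b} → TransClosure Edge/ a b → a ∈ map m (nodes S)
    source∈ [ a∈ , _ ] = a∈
    source∈ ((a∈ , _) ∷ _) = a∈

    acyclic/ : ∀ {a} → ¬ TransClosure Edge/ a a
    acyclic/ cycle with ∈-map⁻ m (source∈ cycle)
    ... | a , a∈ , refl with lift-path a∈ cycle
    ...   | b , b∈ , path , mb≡ma = acyclic S (restart b∈ same-succ path)
      where
      same-succ : succ S a ≡ succ S b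
      same-succ = begin
        succ S a     ≡⟨ succ-preserved a∈ ⟩
        succ S (m a) ≡⟨ cong (succ S) mb≡ma ⟨
        succ S (m b) ≡⟨ succ-preserved b∈ ⟨
        succ S b     ∎
        where open ≡-Reasoning

    graph : TG
    graph = record
      { nodes = map m (nodes S)
      ; root = m (root S)
      ; lab = lab S
      ; succ = map m ∘ succ S
      ; root∈ = ∈-map⁺ m (root∈ S)
      ; succ∈ = λ a∈ → All.tabulate (succ∈/ a∈)
      ; arityOK = λ {a} a∈ lab≡ → trans (length-map m (succ S a)) (arityOK S (image⊆ a∈) lab≡)
      ; varLeaf = λ a∈ lab≡ → cong (map m) (varLeaf S (image⊆ a∈) lab≡)
      ; varUnique = λ a∈ b∈ → varUnique S (image⊆ a∈) (image⊆ b∈)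
      ; acyclic = acyclic/
      ; rooted = rooted/
      }
      where
      succ∈/ : ∀ {a b} → a ∈ map m (nodes S) → b ∈ map m (succ S a) → b ∈ map m (nodes S)
      succ∈/ a∈ b∈ with ∈-map⁻ m b∈
      ... | y , y∈ , refl = ∈-map⁺ m (All.lookup (succ∈ S (image⊆ a∈)) y∈)
      rooted/ : ∀ {a} → a ∈ map m (nodes S) → Star Edge/ (m (root S)) a
      rooted/ a∈ with ∈-map⁻ m a∈
      ... | a₀ , a₀∈ , refl = gmap m push-edge (rooted S a₀∈)

    hom-factors : ∀ {T : TG} {m₁ m′} → Hom S T m₁ → m ≗ m′ ∘ m₁ → Hom T graph m′
    hom-factors {T} {m₁} {m′} H@(rt , h) m≗ = root≡ , node
      where
      open ≡-Reasoning
      root≡ : m′ (root T) ≡ m (root S)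
      root≡ = trans (cong m′ (sym rt)) (sym (m≗ (root S)))
      node : ∀ {t} → t ∈ nodes T → (m′ t ∈ map m (nodes S)) ×
             (lab S (m′ t) ≡ lab T t) × (map m (succ S (m′ t)) ≡ map m′ (succ T t))
      node t∈ with hom-onto {S} {T} H t∈
      ... | s , s∈ , refl = subst (_∈ map m (nodes S)) (m≗ s) (∈-map⁺ m s∈) , lab≡ , succ≡
        where
        lab≡ : lab S (m′ (m₁ s)) ≡ lab T (m₁ s)
        lab≡ = begin
          lab S (m′ (m₁ s)) ≡⟨ cong (lab S) (m≗ s) ⟨
          lab S (m s)       ≡⟨ lab-preserved s∈ ⟨
          lab S s           ≡⟨ proj₁ (proj₂ (h s∈)) ⟨
          lab T (m₁ s)      ∎
        succ≡ : map m (succ S (m′ (m₁ s))) ≡ map m′ (succ T (m₁ s))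
        succ≡ = begin
          map m (succ S (m′ (m₁ s)))  ≡⟨ cong (map m ∘ succ S) (m≗ s) ⟨
          map m (succ S (m s))        ≡⟨ cong (map m) (succ-preserved s∈) ⟨
          map m (succ S s)            ≡⟨ map-cong m≗ (succ S s) ⟩
          map (m′ ∘ m₁) (succ S s)    ≡⟨ map-∘ (succ S s) ⟩
          map m′ (map m₁ (succ S s))  ≡⟨ cong (map m′) (proj₂ (proj₂ (h s∈))) ⟨
          map m′ (succ T (m₁ s))      ∎

module TermGraphRedirection {F : Set} (arity : F → ℕ) (V N : Set) (_≟_ : DecidableEquality N) where

  open TermGraphs arity V N
  open Redirection _≟_

  hom-↦⇒twins : ∀ {S T : TG} {a b} → a ∈ nodes S → b ∈ nodes S → Hom S T [ a ↦ b ] → Twins S a b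
  hom-↦⇒twins {S} {T} {a} {b} a∈ b∈ H with a ≟ b
  ... | yes refl = twins-refl
  ... | no a≢b = twins lab≡ succ≡
    where
    open ≡-Reasoning
    at-a : (b ∈ nodes T) × (lab T b ≡ lab S a) × (succ T b ≡ map [ a ↦ b ] (succ S a))
    at-a = hom-node {S} {T} H a∈ (↦-source a b)
    at-b : (b ∈ nodes T) × (lab T b ≡ lab S b) × (succ T b ≡ map [ a ↦ b ] (succ S b))
    at-b = hom-node {S} {T} H b∈ (↦-other (a≢b ∘ sym))
    fresh-a : ∀ {c} → c ∈ succ S a → c ≢ a
    fresh-a c∈ refl = acyclic S [ a∈ , c∈ ]
    -- otherwise b = [ a ↦ b ] a would be a successor of b in T
    fresh-b : ∀ {c} → c ∈ succ S b → c ≢ a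
    fresh-b c∈ refl = acyclic T [ proj₁ at-b , b∈succ-b ]
      where
      b∈succ-b : b ∈ succ T b
      b∈succ-b = subst (b ∈_) (sym (proj₂ (proj₂ at-b)))
                   (subst (_∈ map [ a ↦ b ] (succ S b)) (↦-source a b) (∈-map⁺ [ a ↦ b ] c∈))
    lab≡ : lab S a ≡ lab S b
    lab≡ = trans (sym (proj₁ (proj₂ at-a))) (proj₁ (proj₂ at-b))
    succ≡ : succ S a ≡ succ S b
    succ≡ = begin
      succ S a                  ≡⟨ map-↦-fresh fresh-a ⟨
      map [ a ↦ b ] (succ S a)  ≡⟨ proj₂ (proj₂ at-a) ⟨
      succ T b                  ≡⟨ proj₂ (proj₂ at-b) ⟩
      map [ a ↦ b ] (succ S b)  ≡⟨ map-↦-fresh fresh-b ⟩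
      succ S b                  ∎

  twins⇒collapse : ∀ {S : TG} {a b} → b ∈ nodes S → Twins S a b → IsCollapse S [ a ↦ b ]
  twins⇒collapse {a = a} b∈ a~b {x} x∈ with x ≟ a
  ... | yes refl = b∈ , a~b
  ... | no _ = x∈ , twins-refl

module Confluence {F : Set} (arity : F → ℕ) (V N : Set)
                  (_≻_ : N → N → Set) (sto : IsStrictTotalOrder _≡_ _≻_) where

  open IsStrictTotalOrder sto using (_≟_; compare; irrefl) renaming (trans to ≻-trans)
  open TermGraphs arity V N
  open Redirection _≟_
  open TermGraphRedirection arity V N _≟_
  open Collapse using (graph; hom-factors)

  _⪰_ : N → N → Set
  a ⪰ b = (a ≡ b) ⊎ (a ≻ b)

  ⪰∧≢⇒≻ : ∀ {a b} → a ⪰ b → a ≢ b → a ≻ b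
  ⪰∧≢⇒≻ (inj₁ a≡b) a≢b = ⊥-elim (a≢b a≡b)
  ⪰∧≢⇒≻ (inj₂ a≻b) _ = a≻b

  _⊵[_↦_]_ : TG → N → N → TG → Set
  S ⊵[ a ↦ b ] T = Redirect _≻_ sto S a b T

  module _ (S T : TG) {a b : N} (R : S ⊵[ a ↦ b ] T) where

    redirect⇒twins : Twins S a b
    redirect⇒twins = let a∈ , b∈ , _ , H = R in hom-↦⇒twins {S} {T} a∈ b∈ H

    redirect⇒collapse : IsCollapse S [ a ↦ b ]
    redirect⇒collapse = twins⇒collapse (proj₁ (proj₂ R)) redirect⇒twins

    redirect-fixed∈ : ∀ {x} → x ∈ nodes S → [ a ↦ b ] x ≡ x → x ∈ nodes T
    redirect-fixed∈ x∈ fixed = proj₁ (hom-node {S} {T} (proj₂ (proj₂ (proj₂ R))) x∈ fixed)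

    collapse-redirect : ∀ {m x w} (c : IsCollapse S m) → x ∈ nodes T → w ∈ nodes T → x ⪰ w →
                        m ≗ [ x ↦ w ] ∘ [ a ↦ b ] → T ⊵[ x ↦ w ] graph S c
    collapse-redirect c x∈ w∈ x⪰w m≗ =
      x∈ , w∈ , x⪰w , hom-factors S c {T} (proj₂ (proj₂ (proj₂ R))) m≗

    redirect-collapse-target : T ⊵[ b ↦ b ] graph S redirect⇒collapse
    redirect-collapse-target =
      collapse-redirect redirect⇒collapse b∈ b∈ (inj₁ refl) (sym ∘ ↦-refl b ∘ [ a ↦ b ])
      where b∈ = redirect-fixed∈ (proj₁ (proj₂ R)) (↦-target a b)

  Join : TG → TG → N → N → Set
  Join T₁ T₂ u v = Σ N λ w₁ → Σ N λ w₂ → Σ N λ x₁ → Σ N λ x₂ → Σ TG λ U →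
    ((w₁ ≡ u) ⊎ (w₁ ≡ v)) × ((w₂ ≡ u) ⊎ (w₂ ≡ v)) ×
    T₁ ⊵[ x₁ ↦ w₁ ] U × T₂ ⊵[ x₂ ↦ w₂ ] U

  join-swap : ∀ {T₁ T₂ u v} → Join T₂ T₁ v u → Join T₁ T₂ u v
  join-swap (w₁ , w₂ , x₁ , x₂ , U , w₁∈ , w₂∈ , R₁ , R₂) =
    w₂ , w₁ , x₂ , x₁ , U , Sum.swap w₂∈ , Sum.swap w₁∈ , R₂ , R₁

  module _ (S T₁ T₂ : TG) where

    join-identity : ∀ {u v v′} → S ⊵[ u ↦ u ] T₁ → S ⊵[ v′ ↦ v ] T₂ → Join T₁ T₂ u v
    join-identity {u} {v} {v′} R₁ R₂@(v′∈ , v∈ , v′⪰v , _) =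
      v , v , v′ , v , graph S c , inj₂ refl , inj₂ refl ,
      collapse-redirect S T₁ R₁ c (redirect-fixed∈ S T₁ R₁ v′∈ (↦-refl u v′))
        (redirect-fixed∈ S T₁ R₁ v∈ (↦-refl u v)) v′⪰v (cong [ v′ ↦ v ] ∘ sym ∘ ↦-refl u) ,
      redirect-collapse-target S T₂ R₂
      where c = redirect⇒collapse S T₂ R₂

    join-parallel : ∀ {a b} → S ⊵[ a ↦ b ] T₁ → S ⊵[ a ↦ b ] T₂ → Join T₁ T₂ b b
    join-parallel {a} {b} R₁ R₂ =
      b , b , b , b , graph S c , inj₁ refl , inj₁ refl ,
      redirect-collapse-target S T₁ R₁ ,
      collapse-redirect S T₂ R₂ c b∈ b∈ (inj₁ refl) (sym ∘ ↦-refl b ∘ [ a ↦ b ])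
      where
      c = redirect⇒collapse S T₁ R₁
      b∈ = redirect-fixed∈ S T₂ R₂ (proj₁ (proj₂ R₂)) (↦-target a b)

    join-same-source : ∀ {u v u′} → u′ ≢ u → u ≻ v → S ⊵[ u′ ↦ u ] T₁ → S ⊵[ u′ ↦ v ] T₂ →
                       Join T₁ T₂ u v
    join-same-source {u} {v} {u′} u′≢u u≻v R₁@(_ , u∈ , u′⪰u , _) R₂@(_ , v∈ , _ , _) =
      v , v , u , u , graph S c , inj₂ refl , inj₂ refl ,
      collapse-redirect S T₁ R₁ c (redirect-fixed∈ S T₁ R₁ u∈ (↦-target u′ u))
        (redirect-fixed∈ S T₁ R₁ v∈ (↦-other v≢u′)) (inj₂ u≻v) (λ _ → refl) ,
      collapse-redirect S T₂ R₂ c (redirect-fixed∈ S T₂ R₂ u∈ (↦-other (u′≢u ∘ sym)))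
        (redirect-fixed∈ S T₂ R₂ v∈ (↦-target u′ v)) (inj₂ u≻v) (↦-absorb u′ u v)
      where
      v≢u′ : v ≢ u′
      v≢u′ refl = irrefl refl (≻-trans (⪰∧≢⇒≻ u′⪰u u′≢u) u≻v)
      c : IsCollapse S ([ u ↦ v ] ∘ [ u′ ↦ u ])
      c = collapse-∘ (redirect⇒collapse S T₁ R₁)
            (twins⇒collapse v∈ (twins-trans (twins-sym (redirect⇒twins S T₁ R₁))
                                                    (redirect⇒twins S T₂ R₂)))

    join-chain : ∀ {u u′ v′} → u′ ≢ u → v′ ≢ u′ → S ⊵[ u′ ↦ u ] T₁ → S ⊵[ v′ ↦ u′ ] T₂ →
                 Join T₁ T₂ u u′
    join-chain {u} {u′} {v′} u′≢u v′≢u′ R₁@(u′∈ , u∈ , u′⪰u , _) R₂@(v′∈ , _ , v′⪰u′ , _) =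
      u , u , v′ , u′ , graph S c , inj₁ refl , inj₁ refl ,
      collapse-redirect S T₁ R₁ c (redirect-fixed∈ S T₁ R₁ v′∈ (↦-other v′≢u′))
        (redirect-fixed∈ S T₁ R₁ u∈ (↦-target u′ u)) (inj₂ v′≻u) (λ _ → refl) ,
      collapse-redirect S T₂ R₂ c (redirect-fixed∈ S T₂ R₂ u′∈ (↦-target v′ u′))
        (redirect-fixed∈ S T₂ R₂ u∈ (↦-other u≢v′)) (inj₂ u′≻u) (↦-chain u≢v′ (v′≢u′ ∘ sym))
      where
      u′≻u = ⪰∧≢⇒≻ u′⪰u u′≢u
      v′≻u = ≻-trans (⪰∧≢⇒≻ v′⪰u′ v′≢u′) u′≻u
      u≢v′ : u ≢ v′
      u≢v′ refl = irrefl refl v′≻u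
      c : IsCollapse S ([ v′ ↦ u ] ∘ [ u′ ↦ u ])
      c = collapse-∘ (redirect⇒collapse S T₁ R₁)
            (twins⇒collapse u∈ (twins-trans (redirect⇒twins S T₂ R₂) (redirect⇒twins S T₁ R₁)))

    join-disjoint : ∀ {u v u′ v′} → u′ ≢ v′ → u′ ≢ v → v′ ≢ u →
                    S ⊵[ u′ ↦ u ] T₁ → S ⊵[ v′ ↦ v ] T₂ → Join T₁ T₂ u v
    join-disjoint {u} {v} {u′} {v′} u′≢v′ u′≢v v′≢u
                  R₁@(u′∈ , u∈ , u′⪰u , _) R₂@(v′∈ , v∈ , v′⪰v , _) =
      v , u , v′ , u′ , graph S c , inj₂ refl , inj₁ refl ,
      collapse-redirect S T₁ R₁ c (redirect-fixed∈ S T₁ R₁ v′∈ (↦-other (u′≢v′ ∘ sym)))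
        (redirect-fixed∈ S T₁ R₁ v∈ (↦-other (u′≢v ∘ sym))) v′⪰v (λ _ → refl) ,
      collapse-redirect S T₂ R₂ c (redirect-fixed∈ S T₂ R₂ u′∈ (↦-other u′≢v′))
        (redirect-fixed∈ S T₂ R₂ u∈ (↦-other (v′≢u ∘ sym))) u′⪰u (↦-comm u′≢v′ u′≢v (v′≢u ∘ sym))
      where
      c : IsCollapse S ([ v′ ↦ v ] ∘ [ u′ ↦ u ])
      c = collapse-∘ (redirect⇒collapse S T₁ R₁) (redirect⇒collapse S T₂ R₂)

  redirections-join : ∀ (S T₁ T₂ : TG) {u v u′ v′} →
                      S ⊵[ u′ ↦ u ] T₁ → S ⊵[ v′ ↦ v ] T₂ → Join T₁ T₂ u v
  redirections-join S T₁ T₂ {u} {v} {u′} {v′} R₁ R₂ with u′ ≟ u | v′ ≟ v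
  ... | yes refl | _        = join-identity S T₁ T₂ R₁ R₂
  ... | no _     | yes refl = join-swap {T₁} {T₂} (join-identity S T₂ T₁ R₂ R₁)
  ... | no u′≢u  | no v′≢v with u′ ≟ v′
  ...   | yes refl with compare u v
  ...     | tri< u≻v _ _ = join-same-source S T₁ T₂ u′≢u u≻v R₁ R₂
  ...     | tri≈ _ refl _ = join-parallel S T₁ T₂ R₁ R₂
  ...     | tri> _ _ v≻u = join-swap {T₁} {T₂} (join-same-source S T₂ T₁ v′≢v v≻u R₂ R₁)
  redirections-join S T₁ T₂ {u} {v} {u′} {v′} R₁ R₂ | no u′≢u | no v′≢v | no u′≢v′ with u′ ≟ v | v′ ≟ u
  ... | yes refl | _        = join-chain S T₁ T₂ u′≢u v′≢v R₁ R₂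
  ... | no _     | yes refl = join-swap {T₁} {T₂} (join-chain S T₂ T₁ v′≢v u′≢u R₂ R₁)
  ... | no u′≢v  | no v′≢u  = join-disjoint S T₁ T₂ u′≢v′ u′≢v v′≢u R₁ R₂

lemma17 : {F : Set} (arity : F → ℕ) (V N : Set)
    (_≻_ : N → N → Set) (sto : IsStrictTotalOrder _≡_ _≻_)
    (S T₁ T₂ : TermGraph arity V N) (u v u′ v′ : N) →
    Redirect _≻_ sto S u′ u T₁ → Redirect _≻_ sto S v′ v T₂ →
    Σ N λ w₁ → Σ N λ w₂ → Σ N λ x₁ → Σ N λ x₂ →
    Σ (TermGraph arity V N) λ U →
    ((w₁ ≡ u) ⊎ (w₁ ≡ v)) × ((w₂ ≡ u) ⊎ (w₂ ≡ v)) ×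
    Redirect _≻_ sto T₁ x₁ w₁ U × Redirect _≻_ sto T₂ x₂ w₂ U
lemma17 arity V N _≻_ sto S T₁ T₂ u v u′ v′ =
  Confluence.redirections-join arity V N _≻_ sto S T₁ T₂
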